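{- Let $m\ge 2$ be even. Then the sequence $(e_m(n)-o_m(n))_{n=0}^{\infty}$ is $m$-automatic.
   Context: $e_m(n)$ (resp. $o_m(n)$) is the number of partitions of $n$ into powers of $m$ (representations $n=m^{i_1}+\cdots+m^{i_r}$ with $0\le i_1\le\cdots\le i_r$) having an even (resp. odd) number $r$ of parts. For an integer $k\ge2$, a sequence $\mathbf{a}=(a_n)_{n\ge0}$ is $k$-automatic if its $k$-kernel $\{(a_{k^in+j})_{n\ge0} : i\ge 0,\ 0\le j<k^i\}$ is a finite set. -}

module Defs where

open import Data.Nat using (ℕ; zero; suc; _+_; _*_; _^_; _<_; _≟_)
open import Data.Nat.Properties using (≤-totalOrder; _≤?_)
open import Data.Integer using (ℤ; _-_) renaming (+_ to ℤ+)
open import Data.List using (List; []; _∷_; map; length; upTo; concatMap; filter; applyUpTo)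
open import Data.Nat.ListAction using (sum)
open import Data.List.Relation.Unary.Any using (Any)
open import Data.List.Relation.Unary.Sorted.TotalOrder ≤-totalOrder using (Sorted; sorted?)
open import Data.Product using (Σ; ∃; _×_)
open import Relation.Binary.PropositionalEquality using (_≡_)
open import Relation.Nullary.Decidable using (_×-dec_)

listsOfLength : ℕ → ℕ → List (List ℕ)
listsOfLength zero    b = [] ∷ []
listsOfLength (suc r) b = concatMap (λ i → map (i ∷_) (listsOfLength r b)) (upTo (suc b))

-- A partition of n into powers of m with exponents i₁ ≤ ⋯ ≤ i_r is
-- represented by the weakly increasing list (i₁ , … , i_r) with
-- m^{i₁} + ⋯ + m^{i_r} = n.
IsPowPartition : ℕ → ℕ → List ℕ → Set
IsPowPartition m n is = Sorted is × sum (map (m ^_) is) ≡ n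

-- For m ≥ 2 every part is ≥ 1 (so r ≤ n) and each exponent i satisfies
-- i < m^i ≤ n; hence all such partitions with r parts appear among the
-- candidates below (r ≤ n, entries ≤ n), each exactly once.
powPartitionsWithParts : ℕ → ℕ → ℕ → List (List ℕ)
powPartitionsWithParts m n r =
  filter (λ is → sorted? _≤?_ is ×-dec (sum (map (m ^_) is) ≟ n)) (listsOfLength r n)

countParts : ℕ → ℕ → ℕ → ℕ
countParts m n r = length (powPartitionsWithParts m n r)

e : ℕ → ℕ → ℕ
e m n = sum (applyUpTo (λ k → countParts m n (2 * k)) (suc n))

o : ℕ → ℕ → ℕ
o m n = sum (applyUpTo (λ k → countParts m n (suc (2 * k))) (suc n))

-- k-kernel membership and k-automaticity (finite kernel, sequences
-- identified extensionally).
InKernel : {A : Set} → ℕ → (ℕ → A) → (ℕ → A) → Set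
InKernel k a b = Σ ℕ λ i → Σ ℕ λ j → j < k ^ i × (∀ n → b n ≡ a (k ^ i * n + j))

SameSeq : {A : Set} → (ℕ → A) → (ℕ → A) → Set
SameSeq a b = ∀ n → a n ≡ b n

IsAutomatic : {A : Set} → ℕ → (ℕ → A) → Set
IsAutomatic k a = Σ (List (ℕ → _)) λ L →
  ∀ b → InKernel k a b → Any (SameSeq b) L

{-# OPTIONS --safe #-}
-- Let f(n) = e_m(n) − o_m(n). Its generating function F(x) = Π_i 1 / (1 + x^(m^i)) satisfies
-- (1 + x) F(x) = F(x^m): a partition of n > 0 either contains the part 1, whose removal flips
-- the parity of the number of parts, or consists of multiples of m and is m times a partition
-- of n / m. For even m, with fₘ(n) = f(mn), this gives f(mn + d) = (−1)^d fₘ(n) and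
-- fₘ(mn + d) = [d even] fₘ(n) for every digit d < m, so the m-kernel lies in {f, fₘ, −fₘ, 0}.
module Submission where

open import Defs
open import Data.Nat using (ℕ; _≤_; _*_)
open import Data.Integer using (ℤ; _-_; +_)
open import Data.Product using (Σ)
open import Relation.Binary.PropositionalEquality using (_≡_)

open import Data.Nat using (zero; suc; _+_; _^_; _∸_; _<_; _≟_; _/_; _%_; z≤n; s≤s; s≤s⁻¹; z<s; NonZero; >-nonZero; parity)
open import Data.Nat.Properties
open import Data.Nat.DivMod using (m≡m%n+[m/n]*n; m%n<n; m<n*o⇒m/o<n)
open import Data.Nat.ListAction using (sum)
import Data.Nat.Tactic.RingSolver as ℕ-Ring
import Data.Integer as ℤ
import Data.Integer.Properties as ℤₚ
import Data.Integer.Tactic.RingSolver as ℤ-Ring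
open import Data.List using (List; []; _∷_; _++_; map; length; upTo; concatMap; filter; applyUpTo)
open import Data.List.Properties using (length-++; filter-++; filter-none; filter-≐; map-applyUpTo; length-map)
open import Data.List.Relation.Unary.All as All using (All; []; _∷_; lookupAny)
open import Data.List.Relation.Unary.Any as Any using (Any; here; there)
open import Data.List.Relation.Unary.Linked using ([]; [-]; _∷_)
open import Data.List.Relation.Unary.Sorted.TotalOrder ≤-totalOrder using (Sorted; sorted?)
open import Data.Product using (_×_; _,_; proj₁; proj₂)
open import Data.Bool using (true; false)
open import Data.Parity.Base using (Parity; 0ℙ; 1ℙ; _⁻¹)
import Data.Parity.Properties as ℙₚ
open import Function using (_∘_; id; _⇔_; mk⇔; Equivalence)
open import Relation.Binary.PropositionalEquality using (refl; sym; trans; cong; cong₂; subst; _≗_; module ≡-Reasoning)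
open import Relation.Nullary using (Dec; yes; no; does; _because_; ¬_; contradiction)
open import Relation.Nullary.Decidable using (_×-dec_)
open import Relation.Unary using (Pred; Decidable)

sum-applyUpTo-cong : ∀ K {g h : ℕ → ℕ} → g ≗ h → sum (applyUpTo g K) ≡ sum (applyUpTo h K)
sum-applyUpTo-cong zero    g≗h = refl
sum-applyUpTo-cong (suc K) g≗h = cong₂ _+_ (g≗h 0) (sum-applyUpTo-cong K (g≗h ∘ suc))

sum-applyUpTo-truncate : ∀ {K₀ K} {g : ℕ → ℕ} → K₀ ≤ K → (∀ i → K₀ ≤ i → g i ≡ 0) →
                         sum (applyUpTo g K) ≡ sum (applyUpTo g K₀)
sum-applyUpTo-truncate {K = zero}  z≤n       _   = refl
sum-applyUpTo-truncate {K = suc K} z≤n       g≡0 =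
  cong₂ _+_ (g≡0 0 z≤n) (sum-applyUpTo-truncate {K = K} z≤n (λ i _ → g≡0 (suc i) z≤n))
sum-applyUpTo-truncate {g = g} (s≤s K₀≤K) g≡0 =
  cong (_+_ (g 0)) (sum-applyUpTo-truncate K₀≤K (λ i K₀≤i → g≡0 (suc i) (s≤s K₀≤i)))

alternatingSum : ℕ → (ℕ → ℕ) → ℤ
alternatingSum zero    g = ℤ.0ℤ
alternatingSum (suc K) g = + g 0 - alternatingSum K (g ∘ suc)

alternatingSum-cong : ∀ K {g h : ℕ → ℕ} → g ≗ h → alternatingSum K g ≡ alternatingSum K h
alternatingSum-cong zero    g≗h = refl
alternatingSum-cong (suc K) g≗h = cong₂ _-_ (cong +_ (g≗h 0)) (alternatingSum-cong K (g≗h ∘ suc))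

alternatingSum-truncate : ∀ {K₀ K} {g : ℕ → ℕ} → K₀ ≤ K → (∀ r → K₀ ≤ r → g r ≡ 0) →
                          alternatingSum K g ≡ alternatingSum K₀ g
alternatingSum-truncate {K = zero}  z≤n       _   = refl
alternatingSum-truncate {K = suc K} z≤n       g≡0 =
  cong₂ _-_ (cong +_ (g≡0 0 z≤n)) (alternatingSum-truncate {K = K} z≤n (λ r _ → g≡0 (suc r) z≤n))
alternatingSum-truncate {g = g} (s≤s K₀≤K) g≡0 =
  cong (+ g 0 -_) (alternatingSum-truncate K₀≤K (λ r K₀≤r → g≡0 (suc r) (s≤s K₀≤r)))

alternatingSum-+ : ∀ K (g h : ℕ → ℕ) →
                   alternatingSum K (λ r → g r + h r) ≡ alternatingSum K g ℤ.+ alternatingSum K h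
alternatingSum-+ zero    g h = refl
alternatingSum-+ (suc K) g h = begin
    + (g 0 + h 0) - alternatingSum K (λ r → g (suc r) + h (suc r))
  ≡⟨ cong₂ _-_ (ℤₚ.pos-+ (g 0) (h 0)) (alternatingSum-+ K (g ∘ suc) (h ∘ suc)) ⟩
    (+ g 0 ℤ.+ + h 0) - (alternatingSum K (g ∘ suc) ℤ.+ alternatingSum K (h ∘ suc))
  ≡⟨ regroup (+ g 0) (+ h 0) (alternatingSum K (g ∘ suc)) (alternatingSum K (h ∘ suc)) ⟩
    (+ g 0 - alternatingSum K (g ∘ suc)) ℤ.+ (+ h 0 - alternatingSum K (h ∘ suc)) ∎
  where
  open ≡-Reasoning
  regroup : ∀ a b A B → (a ℤ.+ b) - (A ℤ.+ B) ≡ (a - A) ℤ.+ (b - B)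
  regroup = ℤ-Ring.solve-∀

alternatingSum-evens-odds : ∀ K (g : ℕ → ℕ) →
  + sum (applyUpTo (λ k → g (2 * k)) K) - + sum (applyUpTo (λ k → g (suc (2 * k))) K)
    ≡ alternatingSum (2 * K) g
alternatingSum-evens-odds zero    g = refl
alternatingSum-evens-odds (suc K) g = begin
    + (g 0 + evens) - + (g 1 + odds)
  ≡⟨ cong₂ _-_ (ℤₚ.pos-+ (g 0) evens) (ℤₚ.pos-+ (g 1) odds) ⟩
    (+ g 0 ℤ.+ + evens) - (+ g 1 ℤ.+ + odds)
  ≡⟨ regroup (+ g 0) (+ evens) (+ g 1) (+ odds) ⟩
    + g 0 - (+ g 1 - (+ evens - + odds))
  ≡⟨ cong (λ x → + g 0 - (+ g 1 - x)) (trans (cong₂ (λ x y → + x - + y) evens≡ odds≡)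
                                             (alternatingSum-evens-odds K (g ∘ suc ∘ suc))) ⟩
    alternatingSum (2 + 2 * K) g
  ≡⟨ cong (λ n → alternatingSum n g) (*-suc 2 K) ⟨
    alternatingSum (2 * suc K) g ∎
  where
  open ≡-Reasoning
  evens = sum (applyUpTo (λ k → g (2 * suc k)) K)
  odds  = sum (applyUpTo (λ k → g (suc (2 * suc k))) K)
  evens≡ : evens ≡ sum (applyUpTo (λ k → g (2 + 2 * k)) K)
  evens≡ = sum-applyUpTo-cong K (λ k → cong g (*-suc 2 k))
  odds≡ : odds ≡ sum (applyUpTo (λ k → g (3 + 2 * k)) K)
  odds≡ = sum-applyUpTo-cong K (λ k → cong (g ∘ suc) (*-suc 2 k))
  regroup : ∀ a A b B → (a ℤ.+ A) - (b ℤ.+ B) ≡ a - (b - (A - B))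
  regroup = ℤ-Ring.solve-∀

k*x≤k*q+d⇒x≤q : ∀ k {x q d} → d < k → k * x ≤ k * q + d → x ≤ q
k*x≤k*q+d⇒x≤q k {x} {q} {d} d<k kx≤kq+d = s≤s⁻¹ (*-cancelˡ-< k x (suc q) (begin-strict
    k * x      ≤⟨ kx≤kq+d ⟩
    k * q + d  <⟨ +-monoʳ-< (k * q) d<k ⟩
    k * q + k  ≡⟨ +-comm (k * q) k ⟩
    k + k * q  ≡⟨ *-suc k q ⟨
    k * suc q  ∎))
  where open ≤-Reasoning

k*q+d∸k*x≡k*[q∸x]+d : ∀ k {x q} d → x ≤ q → k * q + d ∸ k * x ≡ k * (q ∸ x) + d
k*q+d∸k*x≡k*[q∸x]+d k {x} {q} d x≤q =
  trans (+-∸-comm d (*-monoʳ-≤ k x≤q)) (cong (_+ d) (sym (*-distribˡ-∸ k q x)))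

guard : ∀ {p} {P : Set p} → Dec P → ℕ → ℕ
guard (true  because _) x = x
guard (false because _) x = 0

module _ {p} {P : Set p} where

  guard-yes : (P? : Dec P) → P → ∀ {x} → guard P? x ≡ x
  guard-yes (yes _)  _ = refl
  guard-yes (no ¬p) p = contradiction p ¬p

  guard-no : (P? : Dec P) → ¬ P → ∀ {x} → guard P? x ≡ 0
  guard-no (yes p) ¬p = contradiction p ¬p
  guard-no (no _)  _  = refl

  guard-vanishes : (P? : Dec P) → ∀ {x} → (P → x ≡ 0) → guard P? x ≡ 0
  guard-vanishes (yes p) x≡0 = x≡0 p
  guard-vanishes (no _)  _   = refl

  guard-cases : (P? : Dec P) → ∀ {x y} → (P → x ≡ y) → (¬ P → x ≡ 0) → x ≡ guard P? y
  guard-cases (yes p)  x≡y _   = x≡y p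
  guard-cases (no ¬p) _   x≡0 = x≡0 ¬p

  guard-⇔ : ∀ {q} {Q : Set q} (P? : Dec P) (Q? : Dec Q) → P ⇔ Q →
            ∀ {x y} → (P → x ≡ y) → guard P? x ≡ guard Q? y
  guard-⇔ (yes p)  (yes _)  _   x≡y = x≡y p
  guard-⇔ (yes p)  (no ¬q) P⇔Q _   = contradiction (Equivalence.to P⇔Q p) ¬q
  guard-⇔ (no ¬p) (yes q)  P⇔Q _   = contradiction (Equivalence.from P⇔Q q) ¬p
  guard-⇔ (no _)   (no _)   _   _   = refl

module _ {a b p} {A : Set a} {B : Set b} {P : Pred B p} (P? : Decidable P) where

  filter-map : (f : A → B) (xs : List A) → filter P? (map f xs) ≡ map f (filter (P? ∘ f) xs)
  filter-map f []       = refl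
  filter-map f (x ∷ xs) with does (P? (f x))
  ... | true  = cong (f x ∷_) (filter-map f xs)
  ... | false = filter-map f xs

  length-filter-concatMap : (f : A → List B) (xs : List A) →
    length (filter P? (concatMap f xs)) ≡ sum (map (λ x → length (filter P? (f x))) xs)
  length-filter-concatMap f []       = refl
  length-filter-concatMap f (x ∷ xs) = begin
      length (filter P? (f x ++ concatMap f xs))
    ≡⟨ cong length (filter-++ P? (f x) (concatMap f xs)) ⟩
      length (filter P? (f x) ++ filter P? (concatMap f xs))
    ≡⟨ length-++ (filter P? (f x)) ⟩
      length (filter P? (f x)) + length (filter P? (concatMap f xs))
    ≡⟨ cong (_+_ (length (filter P? (f x)))) (length-filter-concatMap f xs) ⟩
      sum (map (λ x → length (filter P? (f x))) (x ∷ xs)) ∎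
    where open ≡-Reasoning

Any-SameSeq-trans : ∀ {A : Set} {a b : ℕ → A} {L : List (ℕ → A)} →
                    SameSeq a b → Any (SameSeq b) L → Any (SameSeq a) L
Any-SameSeq-trans a≈b = Any.map (λ b≈c n → trans (a≈b n) (b≈c n))

closed⇒automatic : ∀ {A : Set} k .{{_ : NonZero k}} (a : ℕ → A) (L : List (ℕ → A)) →
  Any (SameSeq a) L →
  All (λ b → ∀ d → d < k → Any (SameSeq (λ n → b (k * n + d))) L) L →
  IsAutomatic k a
closed⇒automatic {A} k a L a∈L closed =
  L , λ b (i , j , j<kⁱ , b≈) → Any-SameSeq-trans b≈ (section∈ i j j<kⁱ)
  where
  section∈ : ∀ i j → j < k ^ i → Any (SameSeq (λ n → a (k ^ i * n + j))) L
  section∈ zero    zero    _ =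
    Any-SameSeq-trans (λ n → cong a (trans (+-identityʳ (1 * n)) (*-identityˡ n))) a∈L
  section∈ zero    (suc j) (s≤s ())
  section∈ (suc i) j j<kⁱ⁺¹ =
    Any-SameSeq-trans (λ n → trans (cong a (split n)) (r∈≈c (k * n + d))) (c-closed d d<k)
    where
    instance
      kⁱ≢0 : NonZero (k ^ i)
      kⁱ≢0 = m^n≢0 k i
    d r : ℕ
    d = j / k ^ i
    r = j % k ^ i
    d<k : d < k
    d<k = m<n*o⇒m/o<n j<kⁱ⁺¹
    r∈ : Any (SameSeq (λ n → a (k ^ i * n + r))) L
    r∈ = section∈ i r (m%n<n j (k ^ i))
    c : ℕ → A
    c = Any.lookup r∈
    c-closed : ∀ d → d < k → Any (SameSeq (λ n → c (k * n + d))) L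
    c-closed = proj₁ (lookupAny closed r∈)
    r∈≈c : SameSeq (λ n → a (k ^ i * n + r)) c
    r∈≈c = proj₂ (lookupAny closed r∈)
    split : ∀ n → k ^ suc i * n + j ≡ k ^ i * (k * n + d) + r
    split n = trans (cong (_+_ (k * k ^ i * n)) (m≡m%n+[m/n]*n j (k ^ i))) (ring k (k ^ i) n r d)
      where
      ring : ∀ k K n r d → k * K * n + (r + d * K) ≡ K * (k * n + d) + r
      ring = ℕ-Ring.solve-∀

parity-suc : ∀ n → parity (suc n) ≡ parity n ⁻¹
parity-suc n = trans (sym (ℙₚ.⁻¹-involutive (parity (suc n)))) (cong _⁻¹ (ℙₚ.suc-homo-⁻¹ n))

parity-odd : ∀ n → parity (suc (2 * n)) ≡ 1ℙ
parity-odd n = trans (parity-suc (2 * n)) (cong _⁻¹ (ℙₚ.*-homo-* 2 n))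

signed : Parity → ℤ → ℤ
signed 0ℙ x = x
signed 1ℙ x = ℤ.- x

ifEven : Parity → ℤ → ℤ
ifEven 0ℙ x = x
ifEven 1ℙ x = ℤ.0ℤ

signed-⁻¹ : ∀ p x → signed (p ⁻¹) x ≡ ℤ.- signed p x
signed-⁻¹ 0ℙ x = refl
signed-⁻¹ 1ℙ x = sym (ℤₚ.neg-involutive x)

signed-⁻¹+ifEven : ∀ p x → signed (p ⁻¹) x ℤ.+ ifEven p x ≡ ifEven (p ⁻¹) x
signed-⁻¹+ifEven 0ℙ x = ℤₚ.+-inverseˡ x
signed-⁻¹+ifEven 1ℙ x = ℤₚ.+-identityʳ x

module PowerPartitions (m : ℕ) (1<m : 1 < m) where

  private instance
    m≢0 : NonZero m
    m≢0 = >-nonZero (<⇒≤ 1<m)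

  n<m^n : ∀ n → n < m ^ n
  n<m^n zero    = s≤s z≤n
  n<m^n (suc n) = begin-strict
      suc n
    <⟨ +-mono-≤ (m^n>0 m n) (n<m^n n) ⟩
      m ^ n + m ^ n
    ≡⟨ cong (_+_ (m ^ n)) (+-identityʳ (m ^ n)) ⟨
      2 * m ^ n
    ≤⟨ *-monoˡ-≤ (m ^ n) 1<m ⟩
      m ^ suc n ∎
    where open ≤-Reasoning

  exponent<size : ∀ {i s} → m ^ i ≤ s → i < s
  exponent<size {i} m^i≤s = <-≤-trans (n<m^n i) m^i≤s

  -- count r lo s is the number of weakly increasing lists of r exponents ≥ lo with Σ m^i = s,
  -- computed by choosing the first exponent i; it satisfies i < m^i ≤ s, so i ≤ s suffices.
  mutual
    count : ℕ → ℕ → ℕ → ℕ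
    count zero    lo zero    = 1
    count zero    lo (suc s) = 0
    count (suc r) lo s       = sum (applyUpTo (countHead r lo s) (suc s))

    countHead : ℕ → ℕ → ℕ → ℕ → ℕ
    countHead r lo s i = guard (lo ≤? i ×-dec m ^ i ≤? s) (count r i (s ∸ m ^ i))

  countHead-vanishes : ∀ r lo s i → s ≤ i → countHead r lo s i ≡ 0
  countHead-vanishes r lo s i s≤i =
    guard-no (lo ≤? i ×-dec m ^ i ≤? s) (λ (_ , m^i≤s) → <⇒≱ (exponent<size m^i≤s) s≤i)

  IsPowPartitionFrom : ℕ → ℕ → List ℕ → Set
  IsPowPartitionFrom lo s is = Sorted (lo ∷ is) × sum (map (m ^_) is) ≡ s

  isPowPartitionFrom? : ∀ lo s → Decidable (IsPowPartitionFrom lo s)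
  isPowPartitionFrom? lo s is = sorted? _≤?_ (lo ∷ is) ×-dec (sum (map (m ^_) is) ≟ s)

  isPowPartitionFrom-∷ : ∀ {lo s i is} →
    IsPowPartitionFrom lo s (i ∷ is) ⇔ ((lo ≤ i × m ^ i ≤ s) × IsPowPartitionFrom i (s ∸ m ^ i) is)
  isPowPartitionFrom-∷ {lo} {s} {i} {is} = mk⇔ to from
    where
    to : IsPowPartitionFrom lo s (i ∷ is) → (lo ≤ i × m ^ i ≤ s) × IsPowPartitionFrom i (s ∸ m ^ i) is
    to (lo≤i ∷ sorted , sum≡s) =
      (lo≤i , subst (m ^ i ≤_) sum≡s (m≤m+n (m ^ i) _)) ,
      sorted , trans (sym (m+n∸m≡n (m ^ i) _)) (cong (_∸ m ^ i) sum≡s)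
    from : (lo ≤ i × m ^ i ≤ s) × IsPowPartitionFrom i (s ∸ m ^ i) is → IsPowPartitionFrom lo s (i ∷ is)
    from ((lo≤i , m^i≤s) , sorted , sum≡) =
      lo≤i ∷ sorted , trans (cong (_+_ (m ^ i)) sum≡) (m+[n∸m]≡n m^i≤s)

  length-filter-listsOfLength : ∀ r {b lo s} → s ≤ b →
    length (filter (isPowPartitionFrom? lo s) (listsOfLength r b)) ≡ count r lo s
  length-filter-listsOfLength zero    {s = zero}  _ = refl
  length-filter-listsOfLength zero    {s = suc s} _ = refl
  length-filter-listsOfLength (suc r) {b} {lo} {s} s≤b = begin
      length (filter P? (concatMap withHead (upTo (suc b))))
    ≡⟨ length-filter-concatMap P? withHead (upTo (suc b)) ⟩
      sum (map (λ i → length (filter P? (withHead i))) (upTo (suc b)))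
    ≡⟨ cong sum (map-applyUpTo id (λ i → length (filter P? (withHead i))) (suc b)) ⟩
      sum (applyUpTo (λ i → length (filter P? (withHead i))) (suc b))
    ≡⟨ sum-applyUpTo-cong (suc b) length-withHead ⟩
      sum (applyUpTo (countHead r lo s) (suc b))
    ≡⟨ sum-applyUpTo-truncate (m≤n⇒m≤1+n s≤b) (countHead-vanishes r lo s) ⟩
      sum (applyUpTo (countHead r lo s) s)
    ≡⟨ sum-applyUpTo-truncate (n≤1+n s) (countHead-vanishes r lo s) ⟨
      count (suc r) lo s ∎
    where
    open ≡-Reasoning
    P? : Decidable (IsPowPartitionFrom lo s)
    P? = isPowPartitionFrom? lo s
    withHead : ℕ → List (List ℕ)
    withHead i = map (i ∷_) (listsOfLength r b)
    length-withHead : ∀ i → length (filter P? (withHead i)) ≡ countHead r lo s i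
    length-withHead i = begin
        length (filter P? (map (i ∷_) (listsOfLength r b)))
      ≡⟨ cong length (filter-map P? (i ∷_) (listsOfLength r b)) ⟩
        length (map (i ∷_) (filter (P? ∘ (i ∷_)) (listsOfLength r b)))
      ≡⟨ length-map (i ∷_) (filter (P? ∘ (i ∷_)) (listsOfLength r b)) ⟩
        length (filter (P? ∘ (i ∷_)) (listsOfLength r b))
      ≡⟨ guard-cases (lo ≤? i ×-dec m ^ i ≤? s) fits ¬fits ⟩
        countHead r lo s i ∎
      where
      fits : lo ≤ i × m ^ i ≤ s →
             length (filter (P? ∘ (i ∷_)) (listsOfLength r b)) ≡ count r i (s ∸ m ^ i)
      fits head = trans
        (cong length (filter-≐ (P? ∘ (i ∷_)) (isPowPartitionFrom? i (s ∸ m ^ i))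
                               ((λ p → proj₂ (Equivalence.to isPowPartitionFrom-∷ p)) ,
                                λ p → Equivalence.from isPowPartitionFrom-∷ (head , p))
                               (listsOfLength r b)))
        (length-filter-listsOfLength r (≤-trans (m∸n≤m s (m ^ i)) s≤b))
      ¬fits : ¬ (lo ≤ i × m ^ i ≤ s) → length (filter (P? ∘ (i ∷_)) (listsOfLength r b)) ≡ 0
      ¬fits ¬head = cong length (filter-none (P? ∘ (i ∷_)) {listsOfLength r b}
        (All.tabulate (λ _ p → ¬head (proj₁ (Equivalence.to isPowPartitionFrom-∷ p)))))

  countParts≡count : ∀ n r → countParts m n r ≡ count r 0 n
  countParts≡count n r = trans
    (cong length (filter-≐ _ (isPowPartitionFrom? 0 n) (from0 , to0) (listsOfLength r n)))
    (length-filter-listsOfLength r ≤-refl)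
    where
    from0 : ∀ {is} → IsPowPartition m n is → IsPowPartitionFrom 0 n is
    from0 {[]}    (_      , sum≡n) = [-] , sum≡n
    from0 {_ ∷ _} (sorted , sum≡n) = z≤n ∷ sorted , sum≡n
    to0 : ∀ {is} → IsPowPartitionFrom 0 n is → IsPowPartition m n is
    to0 {[]}    (_            , sum≡n) = [] , sum≡n
    to0 {_ ∷ _} (_ ∷ sorted , sum≡n) = sorted , sum≡n

  count-vanishes : ∀ r lo s → s < r → count r lo s ≡ 0
  count-vanishes (suc r) lo s (s≤s s≤r) = sum-applyUpTo-truncate {K = suc s} z≤n (λ i _ →
    guard-vanishes (lo ≤? i ×-dec m ^ i ≤? s) (λ (_ , m^i≤s) →
      count-vanishes r i (s ∸ m ^ i) (<-≤-trans (∸-monoʳ-< (m^n>0 m i) m^i≤s) s≤r)))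

  count-split : ∀ r s → count (suc r) 0 (suc s) ≡ count r 0 s + count (suc r) 1 (suc s)
  count-split r s = cong₂ _+_ head-0 (sum-applyUpTo-cong (suc s) head-positive)
    where
    head-0 : countHead r 0 (suc s) 0 ≡ count r 0 s
    head-0 = guard-yes (0 ≤? 0 ×-dec 1 ≤? suc s) (z≤n , s≤s z≤n)
    head-positive : ∀ i → countHead r 0 (suc s) (suc i) ≡ countHead r 1 (suc s) (suc i)
    head-positive i =
      guard-⇔ (0 ≤? suc i ×-dec m ^ suc i ≤? suc s) (1 ≤? suc i ×-dec m ^ suc i ≤? suc s)
        (mk⇔ (λ (_ , fits) → s≤s z≤n , fits) (λ (_ , fits) → z≤n , fits)) (λ _ → refl)

  count-no-parts : ∀ lo {s} → 0 < s → count 0 lo s ≡ 0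
  count-no-parts lo {suc s} _ = refl

  count-scale : ∀ r lo s → count r (suc lo) (m * s) ≡ count r lo s
  count-scale zero    lo zero    = cong (count 0 (suc lo)) (*-zeroʳ m)
  count-scale zero    lo (suc s) = count-no-parts (suc lo) (<-≤-trans z<s (m≤n*m (suc s) m))
  count-scale (suc r) lo s = begin
      count (suc r) (suc lo) (m * s)
    ≡⟨⟩
      sum (applyUpTo (countHead r (suc lo) (m * s) ∘ suc) (m * s))
    ≡⟨ sum-applyUpTo-cong (m * s) head-scale ⟩
      sum (applyUpTo (countHead r lo s) (m * s))
    ≡⟨ sum-applyUpTo-truncate (m≤n*m s m) (countHead-vanishes r lo s) ⟩
      sum (applyUpTo (countHead r lo s) s)
    ≡⟨ sum-applyUpTo-truncate (n≤1+n s) (countHead-vanishes r lo s) ⟨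
      count (suc r) lo s ∎
    where
    open ≡-Reasoning
    head-scale : ∀ i → countHead r (suc lo) (m * s) (suc i) ≡ countHead r lo s i
    head-scale i = guard-⇔ (suc lo ≤? suc i ×-dec m * m ^ i ≤? m * s) (lo ≤? i ×-dec m ^ i ≤? s)
      (mk⇔ (λ (lo≤i , fits) → s≤s⁻¹ lo≤i , *-cancelˡ-≤ m fits)
           (λ (lo≤i , fits) → s≤s lo≤i , *-monoʳ-≤ m fits))
      (λ _ → trans (cong (count r (suc i)) (sym (*-distribˡ-∸ m s (m ^ i))))
                   (count-scale r i (s ∸ m ^ i)))

  count-nonmultiple : ∀ r lo q d → suc d < m → count r (suc lo) (m * q + suc d) ≡ 0
  count-nonmultiple zero    lo q d _   =
    count-no-parts (suc lo) (<-≤-trans z<s (m≤n+m (suc d) (m * q)))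
  count-nonmultiple (suc r) lo q d d<m =
    sum-applyUpTo-truncate {K = suc (m * q + suc d)} z≤n head-vanishes
    where
    head-vanishes : ∀ i → 0 ≤ i → countHead r (suc lo) (m * q + suc d) i ≡ 0
    head-vanishes zero    _ = refl
    head-vanishes (suc i) _ = guard-vanishes (suc lo ≤? suc i ×-dec m * m ^ i ≤? m * q + suc d)
      λ (_ , fits) → let m^i≤q = k*x≤k*q+d⇒x≤q m d<m fits in
        trans (cong (count r (suc i)) (k*q+d∸k*x≡k*[q∸x]+d m (suc d) m^i≤q))
              (count-nonmultiple r i (q ∸ m ^ i) d d<m)

  signedCount : ℕ → ℕ → ℤ
  signedCount lo s = alternatingSum (suc s) (λ r → count r lo s)

  alternatingSum-count : ∀ {K} lo s → s < K → alternatingSum K (λ r → count r lo s) ≡ signedCount lo s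
  alternatingSum-count lo s s<K = alternatingSum-truncate s<K (λ r s<r → count-vanishes r lo s s<r)

  e-o≡signedCount : ∀ n → + e m n - + o m n ≡ signedCount 0 n
  e-o≡signedCount n = begin
      + e m n - + o m n
    ≡⟨ alternatingSum-evens-odds (suc n) (countParts m n) ⟩
      alternatingSum (2 * suc n) (countParts m n)
    ≡⟨ alternatingSum-cong (2 * suc n) (countParts≡count n) ⟩
      alternatingSum (2 * suc n) (λ r → count r 0 n)
    ≡⟨ alternatingSum-count 0 n (m≤n*m (suc n) 2) ⟩
      signedCount 0 n ∎
    where open ≡-Reasoning

  signedCount-suc : ∀ n → signedCount 0 (suc n) ≡ signedCount 1 (suc n) - signedCount 0 n
  signedCount-suc n = begin
      signedCount 0 (suc n)
    ≡⟨⟩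
      + 0 - alternatingSum (suc n) (λ r → count (suc r) 0 (suc n))
    ≡⟨ cong (+ 0 -_) (alternatingSum-cong (suc n) (λ r → count-split r n)) ⟩
      + 0 - alternatingSum (suc n) (λ r → count r 0 n + count (suc r) 1 (suc n))
    ≡⟨ cong (+ 0 -_) (alternatingSum-+ (suc n) (λ r → count r 0 n) (λ r → count (suc r) 1 (suc n))) ⟩
      + 0 - (signedCount 0 n ℤ.+ noOnes)
    ≡⟨ regroup (signedCount 0 n) noOnes ⟩
      (+ 0 - noOnes) - signedCount 0 n ∎
    where
    open ≡-Reasoning
    noOnes : ℤ
    noOnes = alternatingSum (suc n) (λ r → count (suc r) 1 (suc n))
    regroup : ∀ a x → + 0 - (a ℤ.+ x) ≡ (+ 0 - x) - a
    regroup = ℤ-Ring.solve-∀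

  signedCount-scale : ∀ q → signedCount 1 (m * q) ≡ signedCount 0 q
  signedCount-scale q = trans (alternatingSum-cong (suc (m * q)) (λ r → count-scale r 0 q))
                              (alternatingSum-count 0 q (s≤s (m≤n*m q m)))

  signedCount-nonmultiple : ∀ q d → suc d < m → signedCount 1 (m * q + suc d) ≡ ℤ.0ℤ
  signedCount-nonmultiple q d d<m =
    alternatingSum-truncate {K = suc (m * q + suc d)} z≤n (λ r _ → count-nonmultiple r 0 q d d<m)

module EvenBase (h : ℕ) (f g : ℕ → ℤ)
  (f-suc : ∀ n → f (suc n) ≡ g (suc n) - f n)
  (g-multiple : ∀ q → g (2 * suc h * q) ≡ f q)
  (g-nonmultiple : ∀ q d → suc d < 2 * suc h → g (2 * suc h * q + suc d) ≡ ℤ.0ℤ)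
  where

  m : ℕ
  m = 2 * suc h

  fₘ : ℕ → ℤ
  fₘ n = f (m * n)

  last-digit<m : suc (2 * h) < m
  last-digit<m = ≤-reflexive (sym (*-suc 2 h))

  m*suc : ∀ n → m * suc n ≡ suc (m * n + suc (2 * h))
  m*suc n = ring h n
    where
    ring : ∀ h n → 2 * suc h * suc n ≡ suc (2 * suc h * n + suc (2 * h))
    ring = ℕ-Ring.solve-∀

  f-digit : ∀ n d → d < m → f (m * n + d) ≡ signed (parity d) (fₘ n)
  f-digit n zero    _   = cong f (+-identityʳ (m * n))
  f-digit n (suc d) d<m = begin
      f (m * n + suc d)
    ≡⟨ cong f (+-suc (m * n) d) ⟩
      f (suc (m * n + d))
    ≡⟨ f-suc (m * n + d) ⟩
      g (suc (m * n + d)) - f (m * n + d)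
    ≡⟨ cong₂ _-_ (trans (sym (cong g (+-suc (m * n) d))) (g-nonmultiple n d d<m))
                 (f-digit n d (<-trans (n<1+n d) d<m)) ⟩
      ℤ.0ℤ - signed (parity d) (fₘ n)
    ≡⟨ ℤₚ.+-identityˡ _ ⟩
      ℤ.- signed (parity d) (fₘ n)
    ≡⟨ signed-⁻¹ (parity d) (fₘ n) ⟨
      signed (parity d ⁻¹) (fₘ n)
    ≡⟨ cong (λ p → signed p (fₘ n)) (parity-suc d) ⟨
      signed (parity (suc d)) (fₘ n) ∎
    where open ≡-Reasoning

  fₘ-suc : ∀ n → fₘ (suc n) ≡ f (suc n) ℤ.+ fₘ n
  fₘ-suc n = begin
      f (m * suc n)
    ≡⟨ cong f (m*suc n) ⟩
      f (suc (m * n + suc (2 * h)))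
    ≡⟨ f-suc (m * n + suc (2 * h)) ⟩
      g (suc (m * n + suc (2 * h))) - f (m * n + suc (2 * h))
    ≡⟨ cong₂ _-_ (trans (sym (cong g (m*suc n))) (g-multiple (suc n)))
                 (f-digit n (suc (2 * h)) last-digit<m) ⟩
      f (suc n) - signed (parity (suc (2 * h))) (fₘ n)
    ≡⟨ cong (λ p → f (suc n) - signed p (fₘ n)) (parity-odd h) ⟩
      f (suc n) - ℤ.- fₘ n
    ≡⟨ cong (ℤ._+_ (f (suc n))) (ℤₚ.neg-involutive (fₘ n)) ⟩
      f (suc n) ℤ.+ fₘ n ∎
    where open ≡-Reasoning

  fₘ-digit : ∀ n d → d < m → fₘ (m * n + d) ≡ ifEven (parity d) (fₘ n)
  fₘ-digit zero    zero    _   = cong fₘ (trans (+-identityʳ (m * 0)) (*-zeroʳ m))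
  fₘ-digit (suc n) zero    _   = begin
      fₘ (m * suc n + 0)
    ≡⟨ cong fₘ (trans (+-identityʳ (m * suc n)) (m*suc n)) ⟩
      fₘ (suc (m * n + suc (2 * h)))
    ≡⟨ fₘ-suc (m * n + suc (2 * h)) ⟩
      f (suc (m * n + suc (2 * h))) ℤ.+ fₘ (m * n + suc (2 * h))
    ≡⟨ cong₂ ℤ._+_ (sym (cong f (m*suc n))) (fₘ-digit n (suc (2 * h)) last-digit<m) ⟩
      fₘ (suc n) ℤ.+ ifEven (parity (suc (2 * h))) (fₘ n)
    ≡⟨ cong (λ p → fₘ (suc n) ℤ.+ ifEven p (fₘ n)) (parity-odd h) ⟩
      fₘ (suc n) ℤ.+ ℤ.0ℤ
    ≡⟨ ℤₚ.+-identityʳ (fₘ (suc n)) ⟩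
      fₘ (suc n) ∎
    where open ≡-Reasoning
  fₘ-digit n       (suc d) d<m = begin
      fₘ (m * n + suc d)
    ≡⟨ cong fₘ (+-suc (m * n) d) ⟩
      fₘ (suc (m * n + d))
    ≡⟨ fₘ-suc (m * n + d) ⟩
      f (suc (m * n + d)) ℤ.+ fₘ (m * n + d)
    ≡⟨ cong₂ ℤ._+_ (trans (sym (cong f (+-suc (m * n) d))) (f-digit n (suc d) d<m))
                   (fₘ-digit n d (<-trans (n<1+n d) d<m)) ⟩
      signed (parity (suc d)) (fₘ n) ℤ.+ ifEven (parity d) (fₘ n)
    ≡⟨ cong (λ p → signed p (fₘ n) ℤ.+ ifEven (parity d) (fₘ n)) (parity-suc d) ⟩
      signed (parity d ⁻¹) (fₘ n) ℤ.+ ifEven (parity d) (fₘ n)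
    ≡⟨ signed-⁻¹+ifEven (parity d) (fₘ n) ⟩
      ifEven (parity d ⁻¹) (fₘ n)
    ≡⟨ cong (λ p → ifEven p (fₘ n)) (parity-suc d) ⟨
      ifEven (parity (suc d)) (fₘ n) ∎
    where open ≡-Reasoning

  kernel : List (ℕ → ℤ)
  kernel = f ∷ fₘ ∷ (ℤ.-_ ∘ fₘ) ∷ (λ _ → ℤ.0ℤ) ∷ []

  signed∈kernel : ∀ {b} p → SameSeq b (signed p ∘ fₘ) → Any (SameSeq b) kernel
  signed∈kernel 0ℙ b≈ = there (here b≈)
  signed∈kernel 1ℙ b≈ = there (there (here b≈))

  ifEven∈kernel : ∀ {b} p → SameSeq b (ifEven p ∘ fₘ) → Any (SameSeq b) kernel
  ifEven∈kernel 0ℙ b≈ = there (here b≈)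
  ifEven∈kernel 1ℙ b≈ = there (there (there (here b≈)))

  -ifEven∈kernel : ∀ {b} p → SameSeq b (ℤ.-_ ∘ ifEven p ∘ fₘ) → Any (SameSeq b) kernel
  -ifEven∈kernel 0ℙ b≈ = there (there (here b≈))
  -ifEven∈kernel 1ℙ b≈ = there (there (there (here b≈)))

  kernel-closed : All (λ b → ∀ d → d < m → Any (SameSeq (λ n → b (m * n + d))) kernel) kernel
  kernel-closed =
      (λ d d<m → signed∈kernel (parity d) (λ n → f-digit n d d<m))
    ∷ (λ d d<m → ifEven∈kernel (parity d) (λ n → fₘ-digit n d d<m))
    ∷ (λ d d<m → -ifEven∈kernel (parity d) (λ n → cong ℤ.-_ (fₘ-digit n d d<m)))
    ∷ (λ _ _ → there (there (there (here (λ _ → refl)))))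
    ∷ []

  automatic : IsAutomatic m f
  automatic = closed⇒automatic m f kernel (here (λ _ → refl)) kernel-closed

corollary3p5 : (m : ℕ) → 2 ≤ m → Σ ℕ (λ t → m ≡ 2 * t) →
    IsAutomatic m (λ n → + e m n - + o m n)
corollary3p5 .(2 * suc h) 1<m (suc h , refl) =
  EvenBase.automatic h f (signedCount 1) f-suc g-multiple signedCount-nonmultiple
  where
  m : ℕ
  m = 2 * suc h
  open PowerPartitions m 1<m
  f : ℕ → ℤ
  f n = + e m n - + o m n
  f-suc : ∀ n → f (suc n) ≡ signedCount 1 (suc n) - f n
  f-suc n = begin
      f (suc n)                               ≡⟨ e-o≡signedCount (suc n) ⟩
      signedCount 0 (suc n)                   ≡⟨ signedCount-suc n ⟩
      signedCount 1 (suc n) - signedCount 0 n ≡⟨ cong (signedCount 1 (suc n) -_) (e-o≡signedCount n) ⟨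
      signedCount 1 (suc n) - f n             ∎
    where open ≡-Reasoning
  g-multiple : ∀ q → signedCount 1 (m * q) ≡ f q
  g-multiple q = trans (signedCount-scale q) (sym (e-o≡signedCount q))
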